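{- There is no positive integer $n$ such that the Pell number $P_n$ has the Lehmer property; that is, there is no $n\ge 0$ such that $P_n$ is composite and $\phi(P_n)$ divides $P_n-1$.
   Context: The Pell sequence $\{P_n\}_{n\ge 0}$ is defined by $P_0=0$, $P_1=1$ and $P_{n+2}=2P_{n+1}+P_n$ for all $n\ge 0$. Here $\phi$ denotes Euler's totient function. A composite positive integer $N$ is said to have the Lehmer property if $\phi(N)\mid N-1$. -}

module Defs where

open import Data.Nat using (ℕ; zero; suc; _+_; _*_)
open import Data.List using (List; length; filter; upTo; map)
open import Data.Nat.Coprimality using (Coprime; coprime?)

pell : ℕ → ℕ
pell zero = 0
pell (suc zero) = 1
pell (suc (suc n)) = 2 * pell (suc n) + pell n

φ : ℕ → ℕ
φ n = length (filter (λ k → coprime? k n) (map suc (upTo n)))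

{-# OPTIONS --safe #-}
-- A Lehmer number N is squarefree (p² ∣ N gives p ∣ φ(N) ∣ N - 1), so φ(N) = ∏ (p - 1) over its prime
-- factors p₁ ≤ … ≤ p_K, K ≥ 2. Lehmer's argument bounds each p_{j+1} by K (p₁ ⋯ p_j + 1), whence
-- N ≤ 2^(K (2^K - 1)). An even Lehmer number is impossible: an odd prime factor q would give
-- 2 ∣ q - 1 ∣ N - 1, and two factors 2 contradict squarefreeness. For n = 2U + 1 we have
-- P_n = P_U² + P_{U+1}² with P_U, P_{U+1} coprime, so every prime factor of P_n is 1 mod 4 and
-- 4^K ∣ φ(P_n) ∣ P_n - 1. On the other hand P_n - 1 = P_e · 2 · (odd) with e ≤ U + 1 and the 2-adic
-- valuation of P_e is at most that of e, so 4^K ≤ n + 1. This makes 2^(K (2^K - 1)) < 2^(n - 1) ≤ P_n,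
-- contradicting Lehmer's bound.
module Submission where

open import Defs
open import Data.Nat
open import Data.Nat.Properties
open import Data.Nat.Divisibility
open import Data.Nat.Primality
open import Data.Nat.Primality.Factorisation using (factorise; PrimeFactorisation)
open import Data.Nat.Coprimality using (Coprime; coprime?; coprime-divisor; coprime-+) renaming (sym to coprime-sym)
open import Data.Nat.Combinatorics using (_C_; nCk+nC[k+1]≡[n+1]C[k+1]; nCn≡1; nC1≡n; k>n⇒nCk≡0)
open import Data.Nat.ListAction using (product)
open import Data.Nat.ListAction.Properties using (product-++; product-↭; ∈⇒∣product)
open import Data.Nat.Tactic.RingSolver
open import Data.List using (List; []; _∷_; _++_; length; filter; map; applyUpTo)
open import Data.List.Properties using (map-upTo; map-++; ++-assoc; length-++; ++-identityʳ)
open import Data.List.Membership.Propositional using (_∈_)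
open import Data.List.Membership.Propositional.Properties using (∈-map⁺)
open import Data.List.Relation.Unary.All as All using (All; []; _∷_)
open import Data.List.Relation.Unary.All.Properties using (++⁻)
open import Data.List.Relation.Unary.Any using (here; there)
open import Data.List.Relation.Unary.Linked as Linked using (Linked)
open import Data.List.Relation.Unary.Linked.Properties using (Linked⇒All)
open import Data.List.Relation.Binary.Permutation.Propositional using (↭-sym)
open import Data.List.Relation.Binary.Permutation.Propositional.Properties using (All-resp-↭)
import Data.List.Sort as Sort
open import Data.Product using (Σ; ∃; ∃₂; _×_; _,_; proj₁; proj₂)
open import Data.Sum using (inj₁; inj₂; reduce; fromInj₂)
open import Data.Empty using (⊥-elim)
open import Function using (_∘_; _$_)
open import Relation.Nullary using (¬_; contradiction; Dec; yes; no)
open import Relation.Unary using (Pred; Decidable)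
open import Relation.Binary.PropositionalEquality

-- Finite sums

∑ : ℕ → (ℕ → ℕ) → ℕ
∑ zero    f = 0
∑ (suc m) f = f 0 + ∑ m (f ∘ suc)

syntax ∑ m (λ k → e) = ∑[ k < m ] e

∑-last : ∀ m f → ∑ (suc m) f ≡ ∑ m f + f m
∑-last zero    f = +-comm (f 0) 0
∑-last (suc m) f = trans (cong (f 0 +_) (∑-last m (f ∘ suc))) (sym (+-assoc (f 0) _ _))

∑-cong : ∀ m f g → (∀ k → k < m → f k ≡ g k) → ∑ m f ≡ ∑ m g
∑-cong zero    f g f≗g = refl
∑-cong (suc m) f g f≗g = cong₂ _+_ (f≗g 0 z<s) (∑-cong m _ _ (λ k k<m → f≗g (suc k) (s<s k<m)))

∑-distrib-+ : ∀ m f g → ∑[ k < m ] (f k + g k) ≡ ∑ m f + ∑ m g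
∑-distrib-+ zero    f g = refl
∑-distrib-+ (suc m) f g =
  trans (cong (f 0 + g 0 +_) (∑-distrib-+ m _ _)) (+-+-comm (f 0) (g 0) _ _)
  where +-+-comm : ∀ x y z w → x + y + (z + w) ≡ x + z + (y + w)
        +-+-comm = solve-∀

∑-distribˡ-* : ∀ c m f → ∑[ k < m ] (c * f k) ≡ c * ∑ m f
∑-distribˡ-* c zero    f = sym (*-zeroʳ c)
∑-distribˡ-* c (suc m) f = trans (cong (c * f 0 +_) (∑-distribˡ-* c m _)) (sym (*-distribˡ-+ c (f 0) _))

∑-const : ∀ c m → ∑[ _ < m ] c ≡ m * c
∑-const c zero    = refl
∑-const c (suc m) = cong (c +_) (∑-const c m)

∑-∣ : ∀ d m f → (∀ k → k < m → d ∣ f k) → d ∣ ∑ m f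
∑-∣ d zero    f d∣f = d ∣0
∑-∣ d (suc m) f d∣f = ∣m∣n⇒∣m+n (d∣f 0 z<s) (∑-∣ d m _ (λ k k<m → d∣f (suc k) (s<s k<m)))

∑-+ : ∀ a b f → ∑ (a + b) f ≡ ∑ a f + ∑[ k < b ] f (a + k)
∑-+ zero    b f = refl
∑-+ (suc a) b f = trans (cong (f 0 +_) (∑-+ a b (f ∘ suc))) (sym (+-assoc (f 0) _ _))

∑-* : ∀ m n f → ∑ (m * n) f ≡ ∑[ q < m ] ∑[ r < n ] f (q * n + r)
∑-* zero    n f = refl
∑-* (suc m) n f = trans (∑-+ n (m * n) f) (cong (∑ n f +_) (trans (∑-* m n (λ k → f (n + k)))
  (∑-cong m _ _ (λ q _ → ∑-cong n _ _ (λ r _ → cong f (sym (+-assoc n (q * n) r)))))))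

-- Fermat's little theorem and sums of two squares

[k+1]*[n+1]C[k+1]≡[n+1]*nCk : ∀ n k → suc k * (suc n C suc k) ≡ suc n * (n C k)
[k+1]*[n+1]C[k+1]≡[n+1]*nCk zero    zero    = refl
[k+1]*[n+1]C[k+1]≡[n+1]*nCk zero    (suc k) = *-zeroʳ (suc (suc k))
[k+1]*[n+1]C[k+1]≡[n+1]*nCk (suc n) zero    = trans (*-identityˡ _) (trans (nC1≡n (suc (suc n))) (sym (*-identityʳ _)))
[k+1]*[n+1]C[k+1]≡[n+1]*nCk (suc n) (suc k) = begin
    suc (suc k) * (suc (suc n) C suc (suc k))
  ≡⟨ cong (suc (suc k) *_) (sym (nCk+nC[k+1]≡[n+1]C[k+1] (suc n) (suc k))) ⟩
    suc (suc k) * (A + B)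
  ≡⟨ split (suc k) A B ⟩
    suc k * A + A + suc (suc k) * B
  ≡⟨ cong₂ (λ x y → x + A + y) ([k+1]*[n+1]C[k+1]≡[n+1]*nCk n k) ([k+1]*[n+1]C[k+1]≡[n+1]*nCk n (suc k)) ⟩
    suc n * (n C k) + A + suc n * (n C suc k)
  ≡⟨ merge (suc n) (n C k) (n C suc k) A ⟩
    suc n * (n C k + n C suc k) + A
  ≡⟨ cong (λ x → suc n * x + A) (nCk+nC[k+1]≡[n+1]C[k+1] n k) ⟩
    suc n * A + A
  ≡⟨ +-comm (suc n * A) A ⟩
    suc (suc n) * A
  ∎
  where
  open ≡-Reasoning
  A = suc n C suc k
  B = suc n C suc (suc k)
  split : ∀ k x y → suc k * (x + y) ≡ k * x + x + suc k * y
  split = solve-∀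
  merge : ∀ m x y z → m * x + z + m * y ≡ m * (x + y) + z
  merge = solve-∀

binomial-theorem : ∀ a n → suc a ^ n ≡ ∑[ k < suc n ] ((n C k) * a ^ k)
binomial-theorem a zero    = refl
binomial-theorem a (suc n) = begin
    suc a * suc a ^ n
  ≡⟨ cong (suc a *_) (binomial-theorem a n) ⟩
    suc a * X
  ≡⟨ absorb a X Y 1+Y≡X ⟨
    1 + (a * X + Y)
  ≡⟨ cong (λ s → 1 + (s + Y)) (∑-distribˡ-* a (suc n) term) ⟨
    1 + (∑[ k < suc n ] (a * term k) + Y)
  ≡⟨ cong (1 +_) (∑-distrib-+ (suc n) (λ k → a * term k) (term ∘ suc)) ⟨
    1 + ∑[ k < suc n ] (a * term k + term (suc k))
  ≡⟨ cong (1 +_) (∑-cong (suc n) _ _ (λ k _ → pascal k)) ⟩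
    1 + ∑[ k < suc n ] ((suc n C suc k) * a ^ suc k)
  ∎
  where
  open ≡-Reasoning
  term : ℕ → ℕ
  term k = (n C k) * a ^ k
  X = ∑ (suc n) term
  Y = ∑[ k < suc n ] term (suc k)
  1+Y≡X : 1 + Y ≡ X
  1+Y≡X = begin
      1 + Y                  ≡⟨ +-comm 1 Y ⟩
      Y + term 0             ≡⟨ +-comm Y (term 0) ⟩
      ∑ (suc (suc n)) term   ≡⟨ ∑-last (suc n) term ⟩
      X + term (suc n)       ≡⟨ cong (X +_) (cong (_* a ^ suc n) (k>n⇒nCk≡0 (n<1+n n))) ⟩
      X + 0                  ≡⟨ +-identityʳ X ⟩
      X                      ∎
  absorb : ∀ a X Y → 1 + Y ≡ X → 1 + (a * X + Y) ≡ suc a * X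
  absorb a _ Y refl = expand a Y
    where expand : ∀ a Y → 1 + (a * (1 + Y) + Y) ≡ suc a * (1 + Y)
          expand = solve-∀
  pascal : ∀ k → a * term k + term (suc k) ≡ (suc n C suc k) * a ^ suc k
  pascal k = trans (distrib a (n C k) (n C suc k) (a ^ k))
                   (cong (_* a ^ suc k) (nCk+nC[k+1]≡[n+1]C[k+1] n k))
    where distrib : ∀ a x y z → a * (x * z) + y * (a * z) ≡ (x + y) * (a * z)
          distrib = solve-∀

prime∣pCk : ∀ {p k} → Prime p → 0 < k → k < p → p ∣ p C k
prime∣pCk {suc p'} {suc k'} pr _ k<p
  with euclidsLemma (suc k') (suc p' C suc k') pr
         (divides (p' C k') (trans ([k+1]*[n+1]C[k+1]≡[n+1]*nCk p' k') (*-comm (suc p') _)))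
... | inj₁ p∣k = contradiction (∣⇒≤ p∣k) (<⇒≱ k<p)
... | inj₂ p∣C = p∣C

freshmans-dream : ∀ {p} a → Prime p → ∃ λ m → suc a ^ p ≡ 1 + p * m + a ^ p
freshmans-dream {suc p'} a pr = m , (begin
    suc a ^ p
  ≡⟨ binomial-theorem a p ⟩
    1 + ∑ (suc p') middle
  ≡⟨ cong (1 +_) (∑-last p' middle) ⟩
    1 + (∑ p' middle + (p C p) * a ^ p)
  ≡⟨ cong₂ (λ s c → 1 + (s + c * a ^ p)) (trans middle≡mp (*-comm m p)) (nCn≡1 p) ⟩
    1 + (p * m + 1 * a ^ p)
  ≡⟨ cong (λ x → 1 + (p * m + x)) (*-identityˡ (a ^ p)) ⟩
    1 + (p * m + a ^ p)
  ≡⟨ +-assoc 1 (p * m) (a ^ p) ⟨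
    1 + p * m + a ^ p
  ∎)
  where
  open ≡-Reasoning
  p = suc p'
  middle : ℕ → ℕ
  middle k = (p C suc k) * a ^ suc k
  p∣middle : p ∣ ∑ p' middle
  p∣middle = ∑-∣ p p' middle (λ k k<p' → ∣m⇒∣m*n _ (prime∣pCk pr z<s (s<s k<p')))
  open _∣_ p∣middle renaming (quotient to m; equality to middle≡mp)

fermat : ∀ {p} a → Prime p → ∃ λ c → a ^ p ≡ a + p * c
fermat {suc p'} zero    pr = 0 , sym (*-zeroʳ p')
fermat {suc p'} (suc a) pr
  with freshmans-dream a pr | fermat a pr
... | m , dream | c , a^p≡a+pc = m + c , (begin
    suc a ^ p                ≡⟨ dream ⟩
    1 + p * m + a ^ p        ≡⟨ cong (1 + p * m +_) a^p≡a+pc ⟩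
    1 + p * m + (a + p * c)  ≡⟨ regroup p m a c ⟩
    suc a + p * (m + c)      ∎)
  where
  open ≡-Reasoning
  p = suc p'
  regroup : ∀ p m a c → 1 + p * m + (a + p * c) ≡ suc a + p * (m + c)
  regroup = solve-∀

fermat-little : ∀ {p} a → Prime p → ¬ p ∣ a → p ∣ a ^ (p ∸ 1) ∸ 1
fermat-little {suc p'} zero    pr p∤a = contradiction (suc p' ∣0) p∤a
fermat-little {suc p'} (suc a) pr p∤a =
  fromInj₂ (λ p∣a → contradiction p∣a p∤a) (euclidsLemma (suc a) (suc a ^ p' ∸ 1) pr p∣a[a^p'∸1])
  where
  p∣a[a^p'∸1] : suc p' ∣ suc a * (suc a ^ p' ∸ 1)
  p∣a[a^p'∸1] with fermat (suc a) pr
  ... | c , a^p≡a+pc = divides c (begin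
      suc a * (suc a ^ p' ∸ 1)      ≡⟨ *-distribˡ-∸ (suc a) (suc a ^ p') 1 ⟩
      suc a ^ suc p' ∸ suc a * 1    ≡⟨ cong₂ _∸_ a^p≡a+pc (*-identityʳ (suc a)) ⟩
      suc a + suc p' * c ∸ suc a    ≡⟨ m+n∸m≡n (suc a) _ ⟩
      suc p' * c                    ≡⟨ *-comm (suc p') c ⟩
      c * suc p'                    ∎)
    where open ≡-Reasoning

data EvenOrOdd : ℕ → Set where
  even : ∀ t → EvenOrOdd (2 * t)
  odd  : ∀ t → EvenOrOdd (suc (2 * t))

evenOrOdd : ∀ n → EvenOrOdd n
evenOrOdd zero = even 0
evenOrOdd (suc n) with evenOrOdd n
... | even t = odd t
... | odd t  = subst EvenOrOdd (*-suc 2 t) (even (suc t))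

x+y∣x^[1+2g]+y^[1+2g] : ∀ x y g → x + y ∣ x ^ (1 + 2 * g) + y ^ (1 + 2 * g)
x+y∣x^[1+2g]+y^[1+2g] x y zero = subst (x + y ∣_) (cong₂ _+_ (sym (*-identityʳ x)) (sym (*-identityʳ y))) ∣-refl
x+y∣x^[1+2g]+y^[1+2g] x y (suc g) = subst (λ e → x + y ∣ x ^ e + y ^ e) (cong suc (sym (*-suc 2 g))) step
  where
  A = x ^ (1 + 2 * g)
  B = y ^ (1 + 2 * g)
  expand : ∀ x y A B → (x + y) * (x * A + y * B) ≡ x * y * (A + B) + (x * (x * A) + y * (y * B))
  expand = solve-∀
  step : x + y ∣ x * (x * A) + y * (y * B)
  step = ∣m+n∣m⇒∣n (subst (x + y ∣_) (expand x y A B) (m∣m*n _)) (∣n⇒∣m*n (x * y) (x+y∣x^[1+2g]+y^[1+2g] x y g))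

x^[2n]≡[x*x]^n : ∀ x n → x ^ (2 * n) ≡ (x * x) ^ n
x^[2n]≡[x*x]^n x n = trans (sym (^-*-assoc x 2 n)) (cong (λ y → (x * y) ^ n) (*-identityʳ x))

-- Fermat gives x^(p-1) ≡ y^(p-1) ≡ 1 (mod p), while x² ≡ -y² makes x^(p-1) ≡ -y^(p-1) when (p-1)/2 is odd.
prime∣x²+y²⇒p∣2 : ∀ {p} x y h → Prime p → p ∸ 1 ≡ 2 * (1 + 2 * h) →
                  p ∣ x * x + y * y → ¬ p ∣ x → p ∣ 2
prime∣x²+y²⇒p∣2 {p} x y h pr p∸1≡2[1+2h] p∣x²+y² p∤x =
  ∣m+n∣m⇒∣n (subst (p ∣_) (X+Y≡[X∸1]+[Y∸1]+2 X Y (1≤[z*z]^[1+2h] x p∤x) (1≤[z*z]^[1+2h] y p∤y)) p∣X+Y) (∣m∣n⇒∣m+n p∣X∸1 p∣Y∸1)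
  where
  X = (x * x) ^ (1 + 2 * h)
  Y = (y * y) ^ (1 + 2 * h)
  p∤y : ¬ p ∣ y
  p∤y p∣y = p∤x (reduce (euclidsLemma x x pr (∣m+n∣m⇒∣n (subst (p ∣_) (+-comm (x * x) (y * y)) p∣x²+y²) (∣m⇒∣m*n y p∣y))))
  x^[p∸1]≡X : ∀ x → x ^ (p ∸ 1) ≡ (x * x) ^ (1 + 2 * h)
  x^[p∸1]≡X x = trans (cong (x ^_) p∸1≡2[1+2h]) (x^[2n]≡[x*x]^n x (1 + 2 * h))
  p∣X∸1 : p ∣ X ∸ 1
  p∣X∸1 = subst (λ z → p ∣ z ∸ 1) (x^[p∸1]≡X x) (fermat-little x pr p∤x)
  p∣Y∸1 : p ∣ Y ∸ 1
  p∣Y∸1 = subst (λ z → p ∣ z ∸ 1) (x^[p∸1]≡X y) (fermat-little y pr p∤y)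
  p∣X+Y : p ∣ X + Y
  p∣X+Y = ∣-trans p∣x²+y² (x+y∣x^[1+2g]+y^[1+2g] (x * x) (y * y) h)
  1≤[z*z]^[1+2h] : ∀ z → ¬ p ∣ z → 1 ≤ (z * z) ^ (1 + 2 * h)
  1≤[z*z]^[1+2h] zero    p∤0 = contradiction (p ∣0) p∤0
  1≤[z*z]^[1+2h] (suc z) _   = m^n>0 (suc z * suc z) (1 + 2 * h)
  X+Y≡[X∸1]+[Y∸1]+2 : ∀ X Y → 1 ≤ X → 1 ≤ Y → X + Y ≡ X ∸ 1 + (Y ∸ 1) + 2
  X+Y≡[X∸1]+[Y∸1]+2 (suc X) (suc Y) _ _ = shift X Y
    where shift : ∀ X Y → suc X + suc Y ≡ X + Y + 2
          shift = solve-∀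

prime∣x²+y²⇒4∣p∸1 : ∀ {p} x y → Prime p → ¬ 2 ∣ p → p ∣ x * x + y * y → ¬ p ∣ x → 4 ∣ p ∸ 1
prime∣x²+y²⇒4∣p∸1 {p} x y pr 2∤p p∣x²+y² p∤x with evenOrOdd p
... | even t = contradiction (divides t (*-comm 2 t)) 2∤p
... | odd t with evenOrOdd t
...   | even g = divides g (reassoc g)
  where reassoc : ∀ g → 2 * (2 * g) ≡ g * 4
        reassoc = solve-∀
...   | odd g = contradiction (∣⇒≤ (prime∣x²+y²⇒p∣2 x y g pr refl p∣x²+y² p∤x)) (<⇒≱ 2<p)
  where 2<p : 2 < suc (2 * suc (2 * g))
        2<p = s≤s (s≤s (≤-trans (s≤s z≤n) (m≤n+m (1 * suc (2 * g)) (2 * g))))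

-- Euler's totient

χ : ∀ {A : Set} → Dec A → ℕ
χ (yes _) = 1
χ (no _)  = 0

χ-cong : ∀ {A B : Set} (a : Dec A) (b : Dec B) → (A → B) → (B → A) → χ a ≡ χ b
χ-cong (yes _) (yes _) _   _   = refl
χ-cong (yes a) (no ¬b) a→b _   = contradiction (a→b a) ¬b
χ-cong (no ¬a) (yes b) _   b→a = contradiction (b→a b) ¬a
χ-cong (no _)  (no _)  _   _   = refl

χ-no : ∀ {A : Set} (a : Dec A) → ¬ A → χ a ≡ 0
χ-no (yes a) ¬a = contradiction a ¬a
χ-no (no _)  _  = refl

length-filter-applyUpTo : ∀ {P : Pred ℕ _} (P? : Decidable P) f m →
                          length (filter P? (applyUpTo f m)) ≡ ∑[ k < m ] χ (P? (f k))
length-filter-applyUpTo P? f zero = refl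
length-filter-applyUpTo P? f (suc m) with P? (f 0)
... | yes _ = cong suc (length-filter-applyUpTo P? (f ∘ suc) m)
... | no _  = length-filter-applyUpTo P? (f ∘ suc) m

χ-coprime : ℕ → ℕ → ℕ
χ-coprime n x = χ (coprime? x n)

φ≡∑ : ∀ n → φ n ≡ ∑[ k < n ] χ-coprime n (suc k)
φ≡∑ n = trans (cong (length ∘ filter (λ k → coprime? k n)) (map-upTo suc n))
              (length-filter-applyUpTo (λ k → coprime? k n) suc n)

coprime-∣ʳ : ∀ {x n d} → Coprime x n → d ∣ n → Coprime x d
coprime-∣ʳ x⊥n d∣n (e∣x , e∣d) = x⊥n (e∣x , ∣-trans e∣d d∣n)

coprime-*ʳ : ∀ {x a b} → Coprime x a → Coprime x b → Coprime x (a * b)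
coprime-*ʳ {x} {a} x⊥a x⊥b {d} (d∣x , d∣ab) = x⊥b (d∣x , coprime-divisor d⊥a d∣ab)
  where
  d⊥a : Coprime d a
  d⊥a (e∣d , e∣a) = x⊥a (∣-trans e∣d d∣x , e∣a)

coprime-+⁻ : ∀ {x n} → Coprime (n + x) n → Coprime x n
coprime-+⁻ n+x⊥n (d∣x , d∣n) = n+x⊥n (∣m∣n⇒∣m+n d∣n d∣x , d∣n)

prime⇒2≤ : ∀ {p} → Prime p → 2 ≤ p
prime⇒2≤ {p} pr = nonTrivial⇒n>1 p {{prime⇒nonTrivial pr}}

prime∤⇒coprime : ∀ {p x} → Prime p → ¬ p ∣ x → Coprime x p
prime∤⇒coprime pr p∤x (d∣x , d∣p) with prime⇒irreducible pr d∣p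
... | inj₁ d≡1    = d≡1
... | inj₂ refl   = contradiction d∣x p∤x

coprime⇒prime∤ : ∀ {p x} → Prime p → Coprime x p → ¬ p ∣ x
coprime⇒prime∤ pr x⊥p p∣x = <⇒≢ (prime⇒2≤ pr) (sym (x⊥p (p∣x , ∣-refl)))

χ-coprime-periodic : ∀ n q x → χ-coprime n (q * n + x) ≡ χ-coprime n x
χ-coprime-periodic n zero    x = refl
χ-coprime-periodic n (suc q) x = trans (cong (χ-coprime n) (+-assoc n (q * n) x))
  (trans (χ-cong (coprime? _ n) (coprime? _ n) coprime-+⁻ coprime-+) (χ-coprime-periodic n q x))

∑-χ-coprime-periods : ∀ p n → ∑[ k < p * n ] χ-coprime n (suc k) ≡ p * ∑[ k < n ] χ-coprime n (suc k)
∑-χ-coprime-periods p n = begin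
    ∑[ k < p * n ] χ-coprime n (suc k)
  ≡⟨ ∑-* p n _ ⟩
    ∑[ q < p ] ∑[ r < n ] χ-coprime n (suc (q * n + r))
  ≡⟨ ∑-cong p _ _ (λ q _ → ∑-cong n _ _ (λ r _ → trans (cong (χ-coprime n) (sym (+-suc (q * n) r)))
                                                        (χ-coprime-periodic n q (suc r)))) ⟩
    ∑[ q < p ] ∑[ r < n ] χ-coprime n (suc r)
  ≡⟨ ∑-const _ p ⟩
    p * ∑[ k < n ] χ-coprime n (suc k)
  ∎
  where open ≡-Reasoning

φ-*-∣ : ∀ p n → p ∣ n → φ (p * n) ≡ p * φ n
φ-*-∣ p n p∣n = begin
    φ (p * n)                                ≡⟨ φ≡∑ (p * n) ⟩
    ∑[ k < p * n ] χ-coprime (p * n) (suc k) ≡⟨ ∑-cong (p * n) _ _ (λ k _ → χ-cong (coprime? _ _) (coprime? _ _)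
                                                   (λ x⊥pn → coprime-∣ʳ x⊥pn (n∣m*n p))
                                                   (λ x⊥n → coprime-*ʳ (coprime-∣ʳ x⊥n p∣n) x⊥n)) ⟩
    ∑[ k < p * n ] χ-coprime n (suc k)       ≡⟨ ∑-χ-coprime-periods p n ⟩
    p * ∑[ k < n ] χ-coprime n (suc k)       ≡⟨ cong (p *_) (φ≡∑ n) ⟨
    p * φ n                                  ∎
  where open ≡-Reasoning

χ-coprime-split : ∀ {p} n x → Prime p → χ-coprime n x ≡ χ-coprime (p * n) x + χ (p ∣? x) * χ-coprime n x
χ-coprime-split {p} n x pr with coprime? x n | p ∣? x | coprime? x (p * n)
... | yes _    | yes p∣x | yes x⊥pn = contradiction p∣x (coprime⇒prime∤ pr (coprime-∣ʳ x⊥pn (m∣m*n n)))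
... | yes _    | yes _   | no _     = refl
... | yes _    | no _    | yes _    = refl
... | yes x⊥n  | no p∤x  | no x⊥̸pn = ⊥-elim (x⊥̸pn (coprime-*ʳ (prime∤⇒coprime pr p∤x) x⊥n))
... | no x⊥̸n  | _       | yes x⊥pn = ⊥-elim (x⊥̸n (coprime-∣ʳ x⊥pn (n∣m*n p)))
... | no _     | yes _   | no _     = refl
... | no _     | no _    | no _     = refl

∑-multiples : ∀ p' m (f : ℕ → ℕ) → let p = suc p' in
              ∑[ k < m * p ] (χ (p ∣? suc k) * f (suc k)) ≡ ∑[ j < m ] f (suc j * p)
∑-multiples p' m f = begin
    ∑[ k < m * p ] g (suc k)
  ≡⟨ ∑-* m p _ ⟩
    ∑[ j < m ] ∑[ t < p ] g (suc (j * p + t))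
  ≡⟨ ∑-cong m _ _ (λ j _ → trans (∑-last p' _) (cong₂ _+_ (inner-zero j) (last j))) ⟩
    ∑[ j < m ] (0 + f (suc j * p))
  ∎
  where
  open ≡-Reasoning
  p = suc p'
  g : ℕ → ℕ
  g x = χ (p ∣? x) * f x
  inner-zero : ∀ j → ∑[ t < p' ] g (suc (j * p + t)) ≡ 0
  inner-zero j = trans (∑-cong p' _ _ (λ t t<p' → cong (_* f (suc (j * p + t))) (χ-no (p ∣? _) (p∤ t t<p'))))
                       (trans (∑-const 0 p') (*-zeroʳ p'))
    where
    p∤ : ∀ t → t < p' → ¬ p ∣ suc (j * p + t)
    p∤ t t<p' p∣ = <⇒≱ (s≤s t<p') (∣⇒≤ (∣m+n∣m⇒∣n (subst (p ∣_) (sym (+-suc (j * p) t)) p∣) (n∣m*n j)))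
  last : ∀ j → g (suc (j * p + p')) ≡ f (suc j * p)
  last j rewrite +-comm (j * p) p' with p ∣? suc (p' + j * p)
  ... | yes _   = +-identityʳ _
  ... | no p∤jp = contradiction (n∣m*n (suc j)) p∤jp

-- Counting 1 ≤ x ≤ pn: those coprime to n are those coprime to pn together with the multiples p j of p,
-- where j ≤ n is coprime to n.
φ-*-∤ : ∀ {p} n → Prime p → ¬ p ∣ n → φ (p * n) ≡ (p ∸ 1) * φ n
φ-*-∤ {suc p'} n pr p∤n = begin
    φ (p * n)                       ≡⟨ m+n∸n≡m (φ (p * n)) (φ n) ⟨
    φ (p * n) + φ n ∸ φ n           ≡⟨ cong (_∸ φ n) φ[pn]+φn≡pφn ⟩
    p * φ n ∸ φ n                   ≡⟨ cong (p * φ n ∸_) (*-identityˡ (φ n)) ⟨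
    p * φ n ∸ 1 * φ n               ≡⟨ *-distribʳ-∸ (φ n) p 1 ⟨
    p' * φ n                        ∎
  where
  open ≡-Reasoning
  p = suc p'
  n⊥p : Coprime n p
  n⊥p = prime∤⇒coprime pr p∤n
  multiple : ∀ j → χ-coprime n (suc j * p) ≡ χ-coprime n (suc j)
  multiple j = χ-cong (coprime? _ n) (coprime? _ n)
    (λ jp⊥n → coprime-sym (coprime-∣ʳ (coprime-sym jp⊥n) (m∣m*n p)))
    (λ j⊥n → coprime-sym (coprime-*ʳ (coprime-sym j⊥n) n⊥p))
  φ[pn]+φn≡pφn : φ (p * n) + φ n ≡ p * φ n
  φ[pn]+φn≡pφn = begin
      φ (p * n) + φ n
    ≡⟨ cong₂ _+_ (φ≡∑ (p * n)) (φ≡∑ n) ⟩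
      ∑[ k < p * n ] χ-coprime (p * n) (suc k) + ∑[ j < n ] χ-coprime n (suc j)
    ≡⟨ cong (∑[ k < p * n ] χ-coprime (p * n) (suc k) +_) (begin
        ∑[ j < n ] χ-coprime n (suc j)                                  ≡⟨ ∑-cong n _ _ (λ j _ → multiple j) ⟨
        ∑[ j < n ] χ-coprime n (suc j * p)                              ≡⟨ ∑-multiples p' n (χ-coprime n) ⟨
        ∑[ k < n * p ] (χ (p ∣? suc k) * χ-coprime n (suc k))          ≡⟨ cong (λ m → ∑[ k < m ] (χ (p ∣? suc k) * χ-coprime n (suc k))) (*-comm n p) ⟩
        ∑[ k < p * n ] (χ (p ∣? suc k) * χ-coprime n (suc k))          ∎) ⟩
      ∑[ k < p * n ] χ-coprime (p * n) (suc k) + ∑[ k < p * n ] (χ (p ∣? suc k) * χ-coprime n (suc k))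
    ≡⟨ ∑-distrib-+ (p * n) _ _ ⟨
      ∑[ k < p * n ] (χ-coprime (p * n) (suc k) + χ (p ∣? suc k) * χ-coprime n (suc k))
    ≡⟨ ∑-cong (p * n) _ _ (λ k _ → χ-coprime-split n (suc k) pr) ⟨
      ∑[ k < p * n ] χ-coprime n (suc k)
    ≡⟨ ∑-χ-coprime-periods p n ⟩
      p * ∑[ k < n ] χ-coprime n (suc k)
    ≡⟨ cong (p *_) (φ≡∑ n) ⟨
      p * φ n
    ∎

p²∣n⇒p∣φn : ∀ p n → p * p ∣ n → p ∣ φ n
p²∣n⇒p∣φn p n (divides m refl) = subst (p ∣_) φ[pmp]≡ (m∣m*n (φ (m * p)))
  where
  φ[pmp]≡ : p * φ (m * p) ≡ φ (m * (p * p))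
  φ[pmp]≡ = trans (sym (φ-*-∣ p (m * p) (n∣m*n m))) (cong φ (reassoc m p))
    where reassoc : ∀ m p → p * (m * p) ≡ m * (p * p)
          reassoc = solve-∀

φ-product-of-distinct-primes : ∀ ps → All Prime ps → (∀ p → Prime p → ¬ p * p ∣ product ps) →
                               φ (product ps) ≡ product (map (_∸ 1) ps)
φ-product-of-distinct-primes []       []          _    = refl
φ-product-of-distinct-primes (p ∷ ps) (pr ∷ prs) sqfree =
  trans (φ-*-∤ (product ps) pr (λ p∣ps → sqfree p pr (*-monoʳ-∣ p p∣ps)))
        (cong ((p ∸ 1) *_) (φ-product-of-distinct-primes ps prs (λ q qr q²∣ps → sqfree q qr (∣n⇒∣m*n p q²∣ps))))

-- Pell numbers

pell-+ : ∀ m n → pell (suc (m + n)) ≡ pell (suc m) * pell (suc n) + pell m * pell n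
pell-+ zero    n = sym (trans (cong (_+ 0) (*-identityˡ (pell (suc n)))) (+-identityʳ _))
pell-+ (suc m) n = trans (cong (pell ∘ suc) (sym (+-suc m n)))
                         (trans (pell-+ m (suc n)) (regroup (pell (suc m)) (pell (suc n)) (pell n) (pell m)))
  where
  regroup : ∀ A B C D → A * (2 * B + C) + D * B ≡ (2 * A + D) * B + A * C
  regroup = solve-∀

pell[2+2t] : ∀ t → pell (2 * suc t) ≡ 2 * pell (suc (2 * t)) + pell (2 * t)
pell[2+2t] t = cong pell (*-suc 2 t)

pell[3+2t] : ∀ t → pell (suc (2 * suc t)) ≡ 2 * pell (2 * suc t) + pell (suc (2 * t))
pell[3+2t] t = trans (cong (pell ∘ suc) (*-suc 2 t)) (cong (λ x → 2 * x + pell (suc (2 * t))) (sym (pell[2+2t] t)))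

2∣pell[2t] : ∀ t → 2 ∣ pell (2 * t)
2∣pell[2t] zero    = 2 ∣0
2∣pell[2t] (suc t) = subst (2 ∣_) (sym (pell[2+2t] t)) (∣m∣n⇒∣m+n (m∣m*n (pell (suc (2 * t)))) (2∣pell[2t] t))

2∤pell[1+2t] : ∀ t → ¬ 2 ∣ pell (suc (2 * t))
2∤pell[1+2t] zero    2∣1 = contradiction (∣1⇒≡1 2∣1) λ ()
2∤pell[1+2t] (suc t) 2∣P = 2∤pell[1+2t] t
  (∣m+n∣m⇒∣n (subst (2 ∣_) (pell[3+2t] t) 2∣P) (m∣m*n (pell (2 * suc t))))

2∤pell[1+j]+pell[j] : ∀ j → ¬ 2 ∣ pell (suc j) + pell j
2∤pell[1+j]+pell[j] j with evenOrOdd j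
... | even t = λ 2∣sum → 2∤pell[1+2t] t (∣m+n∣m⇒∣n (subst (2 ∣_) (+-comm _ (pell (2 * t))) 2∣sum) (2∣pell[2t] t))
... | odd t  = λ 2∣sum → 2∤pell[1+2t] t (∣m+n∣m⇒∣n 2∣sum (subst (2 ∣_) (cong pell (*-suc 2 t)) (2∣pell[2t] (suc t))))

pell-double : ∀ j → pell (2 * suc j) ≡ pell (suc j) * (2 * (pell (suc j) + pell j))
pell-double j = trans (cong pell (2[1+j]≡1+j+[1+j] j)) (trans (pell-+ j (suc j)) (factor (pell (suc j)) (pell j)))
  where
  2[1+j]≡1+j+[1+j] : ∀ j → 2 * suc j ≡ suc (j + suc j)
  2[1+j]≡1+j+[1+j] = solve-∀
  factor : ∀ A B → A * (2 * A + B) + B * A ≡ A * (2 * (A + B))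
  factor = solve-∀

pell-sum-of-squares : ∀ n → pell (suc (2 * n)) ≡ pell (suc n) * pell (suc n) + pell n * pell n
pell-sum-of-squares n = trans (cong (λ m → pell (suc (n + m))) (+-identityʳ n)) (pell-+ n n)

cassini-step : ∀ x y → y * y ≡ x * (2 * y + x) + 1 →
               let x' = 2 * y + x; y' = 2 * x' + y in y' * y' ≡ x' * (2 * y' + x') + 1
cassini-step x y y²≡x[2y+x]+1 = +-cancelʳ-≡ _ _ _ (begin
    y' * y' + x * (2 * y + x)                   ≡⟨ identity x y ⟩
    x' * (2 * y' + x') + y * y                  ≡⟨ cong (x' * (2 * y' + x') +_) y²≡x[2y+x]+1 ⟩
    x' * (2 * y' + x') + (x * (2 * y + x) + 1)  ≡⟨ shuffle (x' * (2 * y' + x')) (x * (2 * y + x)) ⟩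
    x' * (2 * y' + x') + 1 + x * (2 * y + x)    ∎)
  where
  open ≡-Reasoning
  x' = 2 * y + x
  y' = 2 * x' + y
  identity : ∀ x y → let x' = 2 * y + x; y' = 2 * x' + y in
             y' * y' + x * (2 * y + x) ≡ x' * (2 * y' + x') + y * y
  identity = solve-∀
  shuffle : ∀ a b → a + (b + 1) ≡ a + 1 + b
  shuffle = solve-∀

cassini : ∀ t → pell (suc (2 * t)) * pell (suc (2 * t)) ≡ pell (2 * t) * pell (suc (suc (2 * t))) + 1
cassini zero    = refl
cassini (suc t) = subst₂ (λ X Y → Y * Y ≡ X * (2 * Y + X) + 1) (sym (pell[2+2t] t)) (sym pell[3+2t]')
                         (cassini-step (pell (2 * t)) (pell (suc (2 * t))) (cassini t))
  where
  pell[3+2t]' : pell (suc (2 * suc t)) ≡ 2 * (2 * pell (suc (2 * t)) + pell (2 * t)) + pell (suc (2 * t))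
  pell[3+2t]' = trans (pell[3+2t] t) (cong (λ a → 2 * a + pell (suc (2 * t))) (pell[2+2t] t))

pell[1+4T] : ∀ T → pell (suc (2 * (2 * T))) ≡ pell (2 * T) * (2 * (pell (suc (2 * T)) + pell (2 * T))) + 1
pell[1+4T] T = trans (pell-sum-of-squares (2 * T)) (collect (pell (2 * T)) (pell (suc (2 * T))) _ (cassini T))
  where collect : ∀ x y Y → Y ≡ x * (2 * y + x) + 1 → Y + x * x ≡ x * (2 * (y + x)) + 1
        collect x y _ refl = identity x y
          where identity : ∀ x y → x * (2 * y + x) + 1 + x * x ≡ x * (2 * (y + x)) + 1
                identity = solve-∀

pell[3+4t] : ∀ t → pell (suc (2 * suc (2 * t))) ≡ pell (suc (suc (2 * t))) * (2 * (pell (suc (2 * t)) + pell (2 * t))) + 1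
pell[3+4t] t = trans (pell-sum-of-squares (suc (2 * t))) (collect (pell (2 * t)) (pell (suc (2 * t))) _ (cassini t))
  where collect : ∀ x y Y → Y ≡ x * (2 * y + x) + 1 → (2 * y + x) * (2 * y + x) + Y ≡ (2 * y + x) * (2 * (y + x)) + 1
        collect x y _ refl = identity x y
          where identity : ∀ x y → (2 * y + x) * (2 * y + x) + (x * (2 * y + x) + 1) ≡ (2 * y + x) * (2 * (y + x)) + 1
                identity = solve-∀

-- By Cassini's identity P_{2U+1} - 1 = P_U² + P_{U+1}² - 1 factors through whichever of P_U, P_{U+1}
-- has even index.
pell[1+2U]≡pell[e]*2x+1 : ∀ U → 0 < U →
  ∃₂ λ e x → 0 < e × e ≤ suc U × ¬ 2 ∣ x × pell (suc (2 * U)) ≡ pell e * (2 * x) + 1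
pell[1+2U]≡pell[e]*2x+1 U 0<U with evenOrOdd U
... | even T = 2 * T , pell (suc (2 * T)) + pell (2 * T) , 0<U , n≤1+n (2 * T) ,
               2∤pell[1+j]+pell[j] (2 * T) , pell[1+4T] T
... | odd t  = suc (suc (2 * t)) , pell (suc (2 * t)) + pell (2 * t) , z<s , ≤-refl ,
               2∤pell[1+j]+pell[j] (2 * t) , pell[3+4t] t

2^s∣x*y⇒2^s∣y : ∀ s {x y} → ¬ 2 ∣ x → 2 ^ s ∣ x * y → 2 ^ s ∣ y
2^s∣x*y⇒2^s∣y zero            _   _          = 1∣ _
2^s∣x*y⇒2^s∣y (suc s) {x} {y} 2∤x 2^[1+s]∣xy with euclidsLemma x y prime[2] (∣-trans (m∣m*n (2 ^ s)) 2^[1+s]∣xy)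
... | inj₁ 2∣x              = contradiction 2∣x 2∤x
... | inj₂ (divides z refl) = subst (2 * 2 ^ s ∣_) (*-comm 2 z) (*-monoʳ-∣ 2 (2^s∣x*y⇒2^s∣y s 2∤x 2^s∣xz))
  where
  2^s∣xz : 2 ^ s ∣ x * z
  2^s∣xz = *-cancelˡ-∣ 2 (subst (2 * 2 ^ s ∣_) (left-comm x z) 2^[1+s]∣xy)
    where left-comm : ∀ x z → x * (z * 2) ≡ 2 * (x * z)
          left-comm = solve-∀

2^[1+s]∣y*2x⇒2^s∣y : ∀ s {x y} → ¬ 2 ∣ x → 2 ^ suc s ∣ y * (2 * x) → 2 ^ s ∣ y
2^[1+s]∣y*2x⇒2^s∣y s {x} {y} 2∤x 2^[1+s]∣y2x =
  2^s∣x*y⇒2^s∣y s 2∤x (*-cancelˡ-∣ 2 (subst (2 * 2 ^ s ∣_) (reassoc y x) 2^[1+s]∣y2x))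
  where reassoc : ∀ y x → y * (2 * x) ≡ 2 * (x * y)
        reassoc = solve-∀

2^s∣pell[m]⇒2^s∣m : ∀ s m → 0 < m → 2 ^ s ∣ pell m → 2 ^ s ∣ m
2^s∣pell[m]⇒2^s∣m zero    m _ _ = 1∣ m
2^s∣pell[m]⇒2^s∣m (suc s) m 0<m 2^[1+s]∣P with evenOrOdd m
... | odd t        = contradiction (∣-trans (m∣m*n (2 ^ s)) 2^[1+s]∣P) (2∤pell[1+2t] t)
... | even (suc j) = *-monoʳ-∣ 2 (2^s∣pell[m]⇒2^s∣m s (suc j) z<s
                       (2^[1+s]∣y*2x⇒2^s∣y s (2∤pell[1+j]+pell[j] j) (subst (2 ^ suc s ∣_) (pell-double j) 2^[1+s]∣P)))

2^s∣pell[1+2U]∸1⇒2^s≤2[1+U] : ∀ s U → 0 < U → 2 ^ s ∣ pell (suc (2 * U)) ∸ 1 → 2 ^ s ≤ 2 * suc U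
2^s∣pell[1+2U]∸1⇒2^s≤2[1+U] zero    U _   _ = s≤s z≤n
2^s∣pell[1+2U]∸1⇒2^s≤2[1+U] (suc s) U 0<U 2^[1+s]∣P∸1 with pell[1+2U]≡pell[e]*2x+1 U 0<U
... | e , x , 0<e , e≤1+U , 2∤x , P≡P[e]*2x+1 = *-monoʳ-≤ 2 (≤-trans (∣⇒≤ {{>-nonZero 0<e}} 2^s∣e) e≤1+U)
  where
  2^s∣e : 2 ^ s ∣ e
  2^s∣e = 2^s∣pell[m]⇒2^s∣m s e 0<e (2^[1+s]∣y*2x⇒2^s∣y s 2∤x
            (subst (2 ^ suc s ∣_) (trans (cong (_∸ 1) P≡P[e]*2x+1) (m+n∸n≡m _ 1)) 2^[1+s]∣P∸1))

pell-coprime : ∀ m → Coprime (pell m) (pell (suc m))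
pell-coprime zero    (_ , d∣1)             = ∣1⇒≡1 d∣1
pell-coprime (suc m) (d∣P[1+m] , d∣P[2+m]) = pell-coprime m (∣m+n∣m⇒∣n d∣P[2+m] (∣n⇒∣m*n 2 d∣P[1+m]) , d∣P[1+m])

2^m≤pell[1+m] : ∀ m → 2 ^ m ≤ pell (suc m)
2^m≤pell[1+m] zero    = ≤-refl
2^m≤pell[1+m] (suc m) = ≤-trans (*-monoʳ-≤ 2 (2^m≤pell[1+m] m)) (m≤m+n _ _)

-- Lehmer's bound

[1+r+t]^r*t≤[r+t]^[1+r] : ∀ r t → suc (r + t) ^ r * t ≤ (r + t) ^ suc r
[1+r+t]^r*t≤[r+t]^[1+r] zero    t = ≤-reflexive (*-comm 1 t)
[1+r+t]^r*t≤[r+t]^[1+r] (suc r) t = begin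
    (suc m * X) * t      ≡⟨ reassoc (suc m) X t ⟩
    X * (suc m * t)      ≤⟨ *-monoʳ-≤ X [1+m]t≤m[1+t] ⟩
    X * (m * suc t)      ≡⟨ left-comm X m (suc t) ⟩
    m * (X * suc t)      ≤⟨ *-monoʳ-≤ m ih ⟩
    m * (m * m ^ r)      ∎
  where
  open ≤-Reasoning
  m = suc r + t
  X = suc m ^ r
  ih : X * suc t ≤ m * m ^ r
  ih = subst (λ k → suc k ^ r * suc t ≤ k * k ^ r) (+-suc r t) ([1+r+t]^r*t≤[r+t]^[1+r] r (suc t))
  reassoc : ∀ a b c → (a * b) * c ≡ b * (a * c)
  reassoc = solve-∀
  left-comm : ∀ a b c → a * (b * c) ≡ b * (a * c)
  left-comm = solve-∀
  [1+m]t≤m[1+t] : suc m * t ≤ m * suc t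
  [1+m]t≤m[1+t] = subst (suc m * t ≤_) (sym (*-suc m t)) (+-monoˡ-≤ (m * t) (m≤n+m t (suc r)))

a[1+m]^r≤[a+1]m^r : ∀ a r t → r * a ≤ t → 1 ≤ t → a * suc (r + t) ^ r ≤ (a + 1) * (r + t) ^ r
a[1+m]^r≤[a+1]m^r a r t@(suc _) ra≤t _ = *-cancelʳ-≤ (a * suc m ^ r) ((a + 1) * m ^ r) t $ begin
    a * suc m ^ r * t       ≡⟨ *-assoc a _ t ⟩
    a * (suc m ^ r * t)     ≤⟨ *-monoʳ-≤ a ([1+r+t]^r*t≤[r+t]^[1+r] r t) ⟩
    a * (m * m ^ r)         ≡⟨ *-assoc a m _ ⟨
    (a * m) * m ^ r         ≤⟨ *-monoˡ-≤ (m ^ r) am≤[a+1]t ⟩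
    ((a + 1) * t) * m ^ r   ≡⟨ swap (a + 1) t (m ^ r) ⟩
    (a + 1) * m ^ r * t     ∎
  where
  open ≤-Reasoning
  m = r + t
  swap : ∀ x y z → (x * y) * z ≡ x * z * y
  swap = solve-∀
  am≤[a+1]t : a * m ≤ (a + 1) * t
  am≤[a+1]t = begin
      a * (r + t)   ≡⟨ distrib a r t ⟩
      r * a + a * t ≤⟨ +-monoˡ-≤ (a * t) ra≤t ⟩
      t + a * t     ≡⟨ collect a t ⟩
      (a + 1) * t   ∎
    where
    distrib : ∀ a r t → a * (r + t) ≡ r * a + a * t
    distrib = solve-∀
    collect : ∀ a t → t + a * t ≡ (a + 1) * t
    collect = solve-∀

kbd+1≡ac⇒[a+1]d+1≤ac : ∀ a b c d k → a * d + 2 ≤ a * c → k * (b * d) + 1 ≡ a * c → (a + 1) * d + 1 ≤ a * c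
kbd+1≡ac⇒[a+1]d+1≤ac a b c d k gap kbd+1≡ac with k * b ≤? a
... | yes kb≤a = contradiction (+-cancelˡ-≤ (a * d) 2 1 (≤-trans gap ac≤ad+1)) λ { (s≤s ()) }
  where
  ac≤ad+1 : a * c ≤ a * d + 1
  ac≤ad+1 = subst (_≤ a * d + 1) kbd+1≡ac
              (+-monoˡ-≤ 1 (subst (_≤ a * d) (*-assoc k b d) (*-monoˡ-≤ d kb≤a)))
... | no kb≰a = subst ((a + 1) * d + 1 ≤_) kbd+1≡ac
                  (+-monoˡ-≤ 1 (subst ((a + 1) * d ≤_) (*-assoc k b d)
                    (*-monoˡ-≤ d (subst (_≤ k * b) (+-comm 1 a) (≰⇒> kb≰a)))))

[a+1]X<aY : ∀ a c d X Y → 1 ≤ X → (a + 1) * d + 1 ≤ a * c → c * X ≤ d * Y → (a + 1) * X < a * Y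
[a+1]X<aY a c d X Y 1≤X [a+1]d+1≤ac cX≤dY = *-cancelˡ-< d ((a + 1) * X) (a * Y) $ begin-strict
    d * ((a + 1) * X)       <⟨ m<m+n _ 1≤X ⟩
    d * ((a + 1) * X) + X   ≡⟨ collect a d X ⟩
    ((a + 1) * d + 1) * X   ≤⟨ *-monoˡ-≤ X [a+1]d+1≤ac ⟩
    (a * c) * X             ≡⟨ *-assoc a c X ⟩
    a * (c * X)             ≤⟨ *-monoʳ-≤ a cX≤dY ⟩
    a * (d * Y)             ≡⟨ left-comm a d Y ⟩
    d * (a * Y)             ∎
  where
  open ≤-Reasoning
  collect : ∀ a d X → d * ((a + 1) * X) + X ≡ ((a + 1) * d + 1) * X
  collect = solve-∀
  left-comm : ∀ a d Y → a * (d * Y) ≡ d * (a * Y)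
  left-comm = solve-∀

-- Lehmer's key step, for N = a c with k φ(N) + 1 = N and φ(N) = b d: the last hypothesis is what c, a product
-- of r primes all at least 1 + m with d = φ(c), gives, and the conclusion bounds the least of them by r (a + 1).
next-prime-bound : ∀ a b c d k m r → 1 ≤ a → 1 ≤ m → 1 ≤ r → a * d + 2 ≤ a * c → k * (b * d) + 1 ≡ a * c →
                   c * m ^ r ≤ d * suc m ^ r → suc m ≤ r * (a + 1)
next-prime-bound a b c d k m r 1≤a 1≤m 1≤r gap kbd+1≡ac cm^r≤d[1+m]^r with r * (a + 1) ≤? m
... | no r[a+1]≰m = ≰⇒> r[a+1]≰m
... | yes r[a+1]≤m with m≤n⇒∃[o]m+o≡n (≤-trans (m≤m*n r (a + 1) {{a+1≢0}}) r[a+1]≤m)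
  where a+1≢0 : NonZero (a + 1)
        a+1≢0 = subst NonZero (+-comm 1 a) _
...   | t , refl = contradiction (a[1+m]^r≤[a+1]m^r a r t ra≤t 1≤t) (<⇒≱ lower)
  where
  lower : (a + 1) * (r + t) ^ r < a * suc (r + t) ^ r
  lower = [a+1]X<aY a c d ((r + t) ^ r) (suc (r + t) ^ r) (1≤m^r (r + t) 1≤m)
            (kbd+1≡ac⇒[a+1]d+1≤ac a b c d k gap kbd+1≡ac) cm^r≤d[1+m]^r
    where 1≤m^r : ∀ m → 1 ≤ m → 1 ≤ m ^ r
          1≤m^r (suc m) _ = m^n>0 (suc m) r
  ra≤t : r * a ≤ t
  ra≤t = +-cancelˡ-≤ r (r * a) t (subst (_≤ r + t) (expand r a) r[a+1]≤m)
    where expand : ∀ r a → r * (a + 1) ≡ r + r * a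
          expand = solve-∀
  1≤t : 1 ≤ t
  1≤t = ≤-trans (*-mono-≤ {1} {r} {1} {a} 1≤r 1≤a) ra≤t

predProduct : List ℕ → ℕ
predProduct ns = product (map (_∸ 1) ns)

1≤product : ∀ {ns} → All (2 ≤_) ns → 1 ≤ product ns
1≤product []         = ≤-refl
1≤product (2≤n ∷ ns) = *-mono-≤ (≤-trans (s≤s z≤n) 2≤n) (1≤product ns)

predProduct≤product : ∀ ns → predProduct ns ≤ product ns
predProduct≤product []       = ≤-refl
predProduct≤product (n ∷ ns) = *-mono-≤ (m∸n≤m n 1) (predProduct≤product ns)

predProduct+product≤product : ∀ n ns → 1 ≤ n → predProduct (n ∷ ns) + product ns ≤ product (n ∷ ns)
predProduct+product≤product (suc n) ns _ = begin
    n * predProduct ns + product ns   ≤⟨ +-monoˡ-≤ (product ns) (*-monoʳ-≤ n (predProduct≤product ns)) ⟩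
    n * product ns + product ns       ≡⟨ +-comm (n * product ns) (product ns) ⟩
    suc n * product ns                ∎
  where open ≤-Reasoning

a*predProduct+2≤a*product : ∀ as n ns → All (2 ≤_) as → All (2 ≤_) (n ∷ ns) → 2 ≤ length as + length (n ∷ ns) →
                            product as * predProduct (n ∷ ns) + 2 ≤ product as * product (n ∷ ns)
a*predProduct+2≤a*product [] n [] _ _ (s≤s ())
a*predProduct+2≤a*product [] n (n' ∷ ns) _ (2≤n ∷ 2≤n' ∷ 2≤ns) _ = begin
    1 * predProduct (n ∷ n' ∷ ns) + 2           ≡⟨ cong (_+ 2) (*-identityˡ _) ⟩
    predProduct (n ∷ n' ∷ ns) + 2               ≤⟨ +-monoʳ-≤ _ (*-mono-≤ 2≤n' (1≤product 2≤ns)) ⟩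
    predProduct (n ∷ n' ∷ ns) + product (n' ∷ ns) ≤⟨ predProduct+product≤product n (n' ∷ ns) (≤-trans (s≤s z≤n) 2≤n) ⟩
    product (n ∷ n' ∷ ns)                       ≡⟨ *-identityˡ _ ⟨
    1 * product (n ∷ n' ∷ ns)                   ∎
  where open ≤-Reasoning
a*predProduct+2≤a*product (a ∷ as) n ns (2≤a ∷ 2≤as) (2≤n ∷ 2≤ns) _ = begin
    A * D + 2                ≤⟨ +-monoʳ-≤ (A * D) (*-mono-≤ 2≤a (1≤product 2≤as)) ⟩
    A * D + A                ≡⟨ *-suc' A D ⟨
    A * (D + 1)              ≤⟨ *-monoʳ-≤ A (+-monoʳ-≤ D (1≤product 2≤ns)) ⟩
    A * (D + product ns)     ≤⟨ *-monoʳ-≤ A (predProduct+product≤product n ns (≤-trans (s≤s z≤n) 2≤n)) ⟩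
    A * product (n ∷ ns)     ∎
  where
  open ≤-Reasoning
  A = product (a ∷ as)
  D = predProduct (n ∷ ns)
  *-suc' : ∀ a d → a * (d + 1) ≡ a * d + a
  *-suc' = solve-∀

product*m^length≤predProduct*[1+m]^length : ∀ m ns → All (suc m ≤_) ns →
  product ns * m ^ length ns ≤ predProduct ns * suc m ^ length ns
product*m^length≤predProduct*[1+m]^length m []           []              = ≤-refl
product*m^length≤predProduct*[1+m]^length m (suc n ∷ ns) (s≤s m≤n ∷ m<ns) = begin
    (suc n * product ns) * (m * m ^ length ns)                 ≡⟨ interchange (suc n) (product ns) m (m ^ length ns) ⟩
    (suc n * m) * (product ns * m ^ length ns)                 ≤⟨ *-mono-≤ [1+n]m≤n[1+m] (product*m^length≤predProduct*[1+m]^length m ns m<ns) ⟩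
    (n * suc m) * (predProduct ns * suc m ^ length ns)         ≡⟨ interchange n (suc m) (predProduct ns) (suc m ^ length ns) ⟩
    (n * predProduct ns) * (suc m * suc m ^ length ns)         ∎
  where
  open ≤-Reasoning
  interchange : ∀ a b c d → (a * b) * (c * d) ≡ (a * c) * (b * d)
  interchange = solve-∀
  [1+n]m≤n[1+m] : suc n * m ≤ n * suc m
  [1+n]m≤n[1+m] = subst (suc n * m ≤_) (sym (*-suc n m)) (+-monoˡ-≤ (n * m) m≤n)

mersenne : ℕ → ℕ
mersenne zero    = 0
mersenne (suc j) = suc (2 * mersenne j)

n≤mersenne[n] : ∀ n → n ≤ mersenne n
n≤mersenne[n] zero    = z≤n
n≤mersenne[n] (suc n) = s≤s (≤-trans (n≤mersenne[n] n) (m≤m+n _ _))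

1+mersenne[n]≡2^n : ∀ n → suc (mersenne n) ≡ 2 ^ n
1+mersenne[n]≡2^n zero    = refl
1+mersenne[n]≡2^n (suc n) = trans (double (mersenne n)) (cong (2 *_) (1+mersenne[n]≡2^n n))
  where double : ∀ x → suc (suc (2 * x)) ≡ 2 * suc x
        double = solve-∀

2^[K*mersenne[1+j]] : ∀ K j → 2 ^ (K * mersenne (suc j)) ≡ 2 ^ K * (2 ^ (K * mersenne j) * 2 ^ (K * mersenne j))
2^[K*mersenne[1+j]] K j = begin
    2 ^ (K * suc (2 * M))                 ≡⟨ cong (2 ^_) (expand K M) ⟩
    2 ^ (K + (K * M + K * M))             ≡⟨ ^-distribˡ-+-* 2 K _ ⟩
    2 ^ K * 2 ^ (K * M + K * M)           ≡⟨ cong (2 ^ K *_) (^-distribˡ-+-* 2 (K * M) (K * M)) ⟩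
    2 ^ K * (2 ^ (K * M) * 2 ^ (K * M))   ∎
  where
  open ≡-Reasoning
  M = mersenne j
  expand : ∀ K x → K * suc (2 * x) ≡ K + (K * x + K * x)
  expand = solve-∀

2*n≤2^n : ∀ n → 2 * n ≤ 2 ^ n
2*n≤2^n zero          = z≤n
2*n≤2^n (suc zero)    = ≤-refl
2*n≤2^n (suc (suc n)) = begin
    2 * suc (suc n)          ≡⟨ *-suc 2 (suc n) ⟩
    2 + 2 * suc n            ≤⟨ +-mono-≤ (*-monoʳ-≤ 2 (m^n>0 2 n)) (2*n≤2^n (suc n)) ⟩
    2 ^ suc n + 2 ^ suc n    ≡⟨ cong (2 ^ suc n +_) (+-identityʳ (2 ^ suc n)) ⟨
    2 ^ suc (suc n)          ∎
  where open ≤-Reasoning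

module _ {ps : List ℕ} {k : ℕ} (2≤ps : All (2 ≤_) ps) (2≤K : 2 ≤ length ps)
         (k*φ+1≡N : k * predProduct ps + 1 ≡ product ps) where

  private
    K = length ps

  next-prime≤2^K*product : ∀ pre q rest → pre ++ q ∷ rest ≡ ps → All (q ≤_) (q ∷ rest) →
                           q ≤ 2 ^ K * product pre
  next-prime≤2^K*product pre zero rest eq _ with ++⁻ pre (subst (All (2 ≤_)) (sym eq) 2≤ps)
  ... | _ , (() ∷ _)
  next-prime≤2^K*product pre (suc m) rest eq q≤q∷rest = begin
      suc m           ≤⟨ q≤r[a+1] ⟩
      r * (a + 1)     ≤⟨ *-mono-≤ r≤K (subst (a + 1 ≤_) (a+a≡2a a) (+-monoʳ-≤ a 1≤a)) ⟩
      K * (2 * a)     ≡⟨ reassoc K a ⟩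
      (2 * K) * a     ≤⟨ *-monoˡ-≤ a (2*n≤2^n K) ⟩
      2 ^ K * a       ∎
    where
    open ≤-Reasoning
    q = suc m
    2≤pre,q∷rest = ++⁻ pre (subst (All (2 ≤_)) (sym eq) 2≤ps)
    2≤pre = proj₁ 2≤pre,q∷rest
    2≤q∷rest = proj₂ 2≤pre,q∷rest
    a = product pre
    b = predProduct pre
    c = product (q ∷ rest)
    d = predProduct (q ∷ rest)
    r = length (q ∷ rest)
    1≤a : 1 ≤ a
    1≤a = 1≤product 2≤pre
    1≤m : 1 ≤ m
    1≤m with 2≤q∷rest
    ... | s≤s 1≤m ∷ _ = 1≤m
    length≡K : length pre + r ≡ K
    length≡K = trans (sym (length-++ pre)) (cong length eq)
    r≤K : r ≤ K
    r≤K = subst (r ≤_) length≡K (m≤n+m r (length pre))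
    N≡ac : product ps ≡ a * c
    N≡ac = trans (cong product (sym eq)) (product-++ pre (q ∷ rest))
    φ≡bd : predProduct ps ≡ b * d
    φ≡bd = trans (cong predProduct (sym eq))
             (trans (cong product (map-++ (_∸ 1) pre (q ∷ rest))) (product-++ (map (_∸ 1) pre) _))
    q≤r[a+1] : suc m ≤ r * (a + 1)
    q≤r[a+1] = next-prime-bound a b c d k m r 1≤a 1≤m (s≤s z≤n)
                 (a*predProduct+2≤a*product pre q rest 2≤pre 2≤q∷rest (subst (2 ≤_) (sym length≡K) 2≤K))
                 (trans (cong (λ x → k * x + 1) (sym φ≡bd)) (trans k*φ+1≡N N≡ac))
                 (product*m^length≤predProduct*[1+m]^length m (q ∷ rest) q≤q∷rest)
    a+a≡2a : ∀ a → a + a ≡ 2 * a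
    a+a≡2a = solve-∀
    reassoc : ∀ K a → K * (2 * a) ≡ (2 * K) * a
    reassoc = solve-∀

  prefix-bound : ∀ pre suf → pre ++ suf ≡ ps → Linked _≤_ suf →
                 product pre ≤ 2 ^ (K * mersenne (length pre)) → product ps ≤ 2 ^ (K * mersenne K)
  prefix-bound pre [] eq _ bound = subst (λ ns → product ns ≤ 2 ^ (K * mersenne (length ns))) pre≡ps bound
    where pre≡ps = trans (sym (++-identityʳ pre)) eq
  prefix-bound pre (q ∷ rest) eq sorted bound =
    prefix-bound (pre ++ q ∷ []) rest (trans (++-assoc pre (q ∷ []) rest) eq) (Linked.tail sorted) bound'
    where
    open ≤-Reasoning
    a = product pre
    B = 2 ^ (K * mersenne (length pre))
    product-snoc : product (pre ++ q ∷ []) ≡ a * q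
    product-snoc = trans (product-++ pre (q ∷ [])) (cong (a *_) (*-identityʳ q))
    length-snoc : length (pre ++ q ∷ []) ≡ suc (length pre)
    length-snoc = trans (length-++ pre) (+-comm (length pre) 1)
    bound' : product (pre ++ q ∷ []) ≤ 2 ^ (K * mersenne (length (pre ++ q ∷ [])))
    bound' = subst₂ (λ x j → x ≤ 2 ^ (K * mersenne j)) (sym product-snoc) (sym length-snoc) (begin
        a * q                              ≤⟨ *-monoʳ-≤ a (next-prime≤2^K*product pre q rest eq (Linked⇒All ≤-trans ≤-refl sorted)) ⟩
        a * (2 ^ K * a)                    ≡⟨ left-comm a (2 ^ K) ⟩
        2 ^ K * (a * a)                    ≤⟨ *-monoʳ-≤ (2 ^ K) (*-mono-≤ bound bound) ⟩
        2 ^ K * (B * B)                    ≡⟨ 2^[K*mersenne[1+j]] K (length pre) ⟨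
        2 ^ (K * mersenne (suc (length pre))) ∎)
      where left-comm : ∀ a x → a * (x * a) ≡ x * (a * a)
            left-comm = solve-∀

lehmer-bound : ∀ ps → All (2 ≤_) ps → Linked _≤_ ps → 2 ≤ length ps → predProduct ps ∣ product ps ∸ 1 →
               product ps ≤ 2 ^ (length ps * mersenne (length ps))
lehmer-bound ps 2≤ps sorted 2≤K (divides k N∸1≡kφ) = prefix-bound {k = k} 2≤ps 2≤K k*φ+1≡N [] ps refl sorted 1≤2^[K*0]
  where
  k*φ+1≡N : k * predProduct ps + 1 ≡ product ps
  k*φ+1≡N = trans (cong (_+ 1) (sym N∸1≡kφ)) (m∸n+n≡m (1≤product 2≤ps))
  1≤2^[K*0] : 1 ≤ 2 ^ (length ps * 0)
  1≤2^[K*0] = m^n>0 2 (length ps * 0)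

-- Lehmer numbers among the Pell numbers

sortedPrimeFactorisation : ∀ n → .{{NonZero n}} →
  Σ (List ℕ) λ ps → product ps ≡ n × All Prime ps × Linked _≤_ ps
sortedPrimeFactorisation n = sort factors ,
  trans (product-↭ (sort-↭ factors)) (sym isFactorisation) ,
  All-resp-↭ (↭-sym (sort-↭ factors)) factorsPrime ,
  sort-↗ factors
  where
  open PrimeFactorisation (factorise n)
  open Sort ≤-decTotalOrder using (sort; sort-↭; sort-↗)

composite⇒3≤ : ∀ {n} → Composite n → 3 ≤ n
composite⇒3≤ (hasNonTrivialDivisor {d} d<n _) = ≤-trans (s≤s (nonTrivial⇒n>1 d)) d<n

∣n∧∣n∸1⇒∣1 : ∀ {d n} → 0 < n → d ∣ n → d ∣ n ∸ 1 → d ∣ 1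
∣n∧∣n∸1⇒∣1 0<n d∣n d∣n∸1 = ∣m+n∣m⇒∣n (subst (_ ∣_) (sym (m∸n+n≡m 0<n)) d∣n) d∣n∸1

prime⇒¬∣1 : ∀ {p} → Prime p → ¬ p ∣ 1
prime⇒¬∣1 pr p∣1 = <⇒≢ (prime⇒2≤ pr) (sym (∣1⇒≡1 p∣1))

lehmer⇒squarefree : ∀ {n p} → 0 < n → φ n ∣ n ∸ 1 → Prime p → ¬ p * p ∣ n
lehmer⇒squarefree {n} {p} 0<n φ∣n∸1 pr p²∣n =
  prime⇒¬∣1 pr (∣n∧∣n∸1⇒∣1 0<n (∣-trans (m∣m*n p) p²∣n) (∣-trans (p²∣n⇒p∣φn p n p²∣n) φ∣n∸1))

composite⇒2≤length : ∀ {n ps} → Composite n → product ps ≡ n → All Prime ps → 2 ≤ length ps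
composite⇒2≤length {ps = []}         comp 1≡n _ = contradiction (subst (3 ≤_) (sym 1≡n) (composite⇒3≤ comp)) λ { (s≤s ()) }
composite⇒2≤length {ps = p ∷ []}     comp p*1≡n (pr ∷ []) =
  contradiction (subst Prime (trans (sym (*-identityʳ p)) p*1≡n) pr) (composite⇒¬prime comp)
composite⇒2≤length {ps = _ ∷ _ ∷ _} _ _ _ = s≤s (s≤s z≤n)

record LehmerFactorisation (n : ℕ) : Set where
  field
    primes      : List ℕ
    product≡n   : product primes ≡ n
    allPrime    : All Prime primes
    sorted      : Linked _≤_ primes
    2≤length    : 2 ≤ length primes
    squarefree  : ∀ {p} → Prime p → ¬ p * p ∣ n
    φ≡          : φ n ≡ predProduct primes

lehmerFactorisation : ∀ {n} → Composite n → φ n ∣ n ∸ 1 → LehmerFactorisation n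
lehmerFactorisation {n} comp φ∣n∸1 = record
  { primes     = ps
  ; product≡n  = product≡n
  ; allPrime   = allPrime
  ; sorted     = sorted
  ; 2≤length   = composite⇒2≤length comp product≡n allPrime
  ; squarefree = squarefree
  ; φ≡         = trans (cong φ (sym product≡n))
                   (φ-product-of-distinct-primes ps allPrime λ p pr p²∣ → squarefree pr (subst (p * p ∣_) product≡n p²∣))
  }
  where
  0<n : 0 < n
  0<n = ≤-trans (s≤s z≤n) (composite⇒3≤ comp)
  squarefree : ∀ {p} → Prime p → ¬ p * p ∣ n
  squarefree = lehmer⇒squarefree 0<n φ∣n∸1
  factorisation = sortedPrimeFactorisation n {{>-nonZero 0<n}}
  ps = proj₁ factorisation
  product≡n = proj₁ (proj₂ factorisation)
  allPrime = proj₁ (proj₂ (proj₂ factorisation))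
  sorted = proj₂ (proj₂ (proj₂ factorisation))

2^[2K]≤2[1+U]⇒K*mersenne[K]<2U : ∀ K U → 1 ≤ K → 2 ^ (2 * K) ≤ 2 * suc U → K * mersenne K < 2 * U
2^[2K]≤2[1+U]⇒K*mersenne[K]<2U K U 1≤K 2^[2K]≤2[1+U] = +-cancelʳ-≤ 2 (suc (K * x)) (2 * U) (begin
    suc (K * x) + 2        ≤⟨ +-monoˡ-≤ 2 (s≤s (*-monoˡ-≤ x (n≤mersenne[n] K))) ⟩
    suc (x * x) + 2        ≤⟨ +-monoʳ-≤ (suc (x * x)) (*-monoʳ-≤ 2 1≤x) ⟩
    suc (x * x) + 2 * x    ≡⟨ square x ⟩
    suc x * suc x          ≡⟨ cong₂ _*_ (1+mersenne[n]≡2^n K) (1+mersenne[n]≡2^n K) ⟩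
    2 ^ K * 2 ^ K          ≡⟨ 2^[2K]≡2^K*2^K ⟨
    2 ^ (2 * K)            ≤⟨ 2^[2K]≤2[1+U] ⟩
    2 * suc U              ≡⟨ *-suc 2 U ⟩
    2 + 2 * U              ≡⟨ +-comm 2 (2 * U) ⟩
    2 * U + 2              ∎)
  where
  open ≤-Reasoning
  x = mersenne K
  1≤x : 1 ≤ x
  1≤x = ≤-trans 1≤K (n≤mersenne[n] K)
  square : ∀ x → suc (x * x) + 2 * x ≡ suc x * suc x
  square = solve-∀
  2^[2K]≡2^K*2^K : 2 ^ (2 * K) ≡ 2 ^ K * 2 ^ K
  2^[2K]≡2^K*2^K = trans (cong (λ m → 2 ^ (K + m)) (+-identityʳ K)) (^-distribˡ-+-* 2 K K)

prime≢2⇒2∣p∸1 : ∀ {p} → Prime p → p ≢ 2 → 2 ∣ p ∸ 1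
prime≢2⇒2∣p∸1 {p} pr p≢2 with evenOrOdd p
... | odd t  = divides t (*-comm 2 t)
... | even t with prime⇒irreducible pr (divides t (*-comm 2 t))
...   | inj₁ ()
...   | inj₂ 2≡2t = contradiction (sym 2≡2t) p≢2

∈⇒∸1∣predProduct : ∀ {q ps} → q ∈ ps → q ∸ 1 ∣ predProduct ps
∈⇒∸1∣predProduct q∈ps = ∈⇒∣product (∈-map⁺ (_∸ 1) q∈ps)

4^length∣predProduct : ∀ ps → All (λ p → 4 ∣ p ∸ 1) ps → 4 ^ length ps ∣ predProduct ps
4^length∣predProduct []       []                = ∣-refl
4^length∣predProduct (p ∷ ps) (4∣p∸1 ∷ 4∣ps∸1) = *-pres-∣ 4∣p∸1 (4^length∣predProduct ps 4∣ps∸1)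

2*2∣product : ∀ ps → 2 ≤ length ps → (∀ {q} → q ∈ ps → q ≡ 2) → 2 * 2 ∣ product ps
2*2∣product (x ∷ []) (s≤s ()) _
2*2∣product (x ∷ y ∷ ps) _ all≡2 rewrite all≡2 (here refl) | all≡2 (there (here refl)) =
  subst (2 * 2 ∣_) (*-assoc 2 2 (product ps)) (m∣m*n (product ps))

even-not-lehmer : ∀ {n} → 2 ∣ n → Composite n → ¬ φ n ∣ n ∸ 1
even-not-lehmer {n} 2∣n comp φ∣n∸1 =
  squarefree prime[2] (subst (2 * 2 ∣_) product≡n (2*2∣product primes 2≤length factor≡2))
  where
  open LehmerFactorisation (lehmerFactorisation comp φ∣n∸1)
  factor≡2 : ∀ {q} → q ∈ primes → q ≡ 2
  factor≡2 {q} q∈primes with q ≟ 2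
  ... | yes q≡2 = q≡2
  ... | no  q≢2 = contradiction (∣n∧∣n∸1⇒∣1 (≤-trans (s≤s z≤n) (composite⇒3≤ comp)) 2∣n 2∣n∸1) (prime⇒¬∣1 prime[2])
    where
    2∣n∸1 : 2 ∣ n ∸ 1
    2∣n∸1 = ∣-trans (prime≢2⇒2∣p∸1 (All.lookup allPrime q∈primes) q≢2)
              (∣-trans (∈⇒∸1∣predProduct q∈primes) (subst (_∣ n ∸ 1) φ≡ φ∣n∸1))

prime∣pell[1+2U]⇒4∣p∸1 : ∀ {p} U → Prime p → p ∣ pell (suc (2 * U)) → 4 ∣ p ∸ 1
prime∣pell[1+2U]⇒4∣p∸1 {p} U pr p∣P = prime∣x²+y²⇒4∣p∸1 (pell U) (pell (suc U)) pr 2∤p p∣x²+y² p∤P[U]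
  where
  2∤p : ¬ 2 ∣ p
  2∤p 2∣p = 2∤pell[1+2t] U (∣-trans 2∣p p∣P)
  p∣x²+y² : p ∣ pell U * pell U + pell (suc U) * pell (suc U)
  p∣x²+y² = subst (p ∣_) (trans (pell-sum-of-squares U) (+-comm (pell (suc U) * pell (suc U)) (pell U * pell U))) p∣P
  p∤P[U] : ¬ p ∣ pell U
  p∤P[U] p∣P[U] = prime⇒¬∣1 pr (subst (p ∣_) (pell-coprime U (p∣P[U] , p∣P[1+U])) ∣-refl)
    where
    p∣P[1+U] : p ∣ pell (suc U)
    p∣P[1+U] = reduce (euclidsLemma (pell (suc U)) (pell (suc U)) pr (∣m+n∣m⇒∣n p∣x²+y² (∣m⇒∣m*n (pell U) p∣P[U])))

odd-index-pell-not-lehmer : ∀ U → 0 < U → let N = pell (suc (2 * U)) in Composite N → ¬ φ N ∣ N ∸ 1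
odd-index-pell-not-lehmer U 0<U comp φ∣N∸1 = <-irrefl refl (begin-strict
    N                        ≡⟨ product≡n ⟨
    product primes           ≤⟨ lehmer-bound primes (All.map prime⇒2≤ allPrime) sorted 2≤length
                                  (subst (λ m → predProduct primes ∣ m ∸ 1) (sym product≡n) predProduct∣N∸1) ⟩
    2 ^ (K * mersenne K)     <⟨ ^-monoʳ-< 2 (s≤s (s≤s z≤n)) K*mersenne[K]<2U ⟩
    2 ^ (2 * U)              ≤⟨ 2^m≤pell[1+m] (2 * U) ⟩
    N                        ∎)
  where
  open ≤-Reasoning
  N = pell (suc (2 * U))
  open LehmerFactorisation (lehmerFactorisation comp φ∣N∸1)
  K = length primes
  predProduct∣N∸1 : predProduct primes ∣ N ∸ 1
  predProduct∣N∸1 = subst (_∣ N ∸ 1) φ≡ φ∣N∸1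
  4^K∣N∸1 : 4 ^ K ∣ N ∸ 1
  4^K∣N∸1 = ∣-trans (4^length∣predProduct primes (All.tabulate λ q∈primes →
              prime∣pell[1+2U]⇒4∣p∸1 U (All.lookup allPrime q∈primes) (subst (_ ∣_) product≡n (∈⇒∣product q∈primes))))
              predProduct∣N∸1
  K*mersenne[K]<2U : K * mersenne K < 2 * U
  K*mersenne[K]<2U = 2^[2K]≤2[1+U]⇒K*mersenne[K]<2U K U (≤-trans (s≤s z≤n) 2≤length)
    (2^s∣pell[1+2U]∸1⇒2^s≤2[1+U] (2 * K) U 0<U (subst (_∣ N ∸ 1) (^-*-assoc 2 2 K) 4^K∣N∸1))

theorem1 : (n : ℕ) → ¬ (Composite (pell n) × φ (pell n) ∣ pell n ∸ 1)
theorem1 n (comp , φ∣P∸1) with evenOrOdd n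
... | even t       = even-not-lehmer (2∣pell[2t] t) comp φ∣P∸1
... | odd zero     = contradiction (composite⇒3≤ comp) λ { (s≤s ()) }
... | odd (suc u)  = odd-index-pell-not-lehmer (suc u) z<s comp φ∣P∸1
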